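{- Let $k\geq 1$ and let $\mathbb{C}$ be a $(2k,2^k+1,2k,k)_2$ code which contains $V_0=\{(\mathbf{0},y):y\in\mathbb{F}_2^k\}$ as a codeword and such that every codeword contains at most one nonzero vector of the form $(x,\mathbf{0})$. Let $\overleftrightarrow{\mathbb{C}}=\{\{(y,x):(x,y)\in Z\}: Z\in\mathbb{C}\}$. Then $\overleftrightarrow{\mathbb{C}}$ is a spread in $\mathcal{G}_2(2k,k)$ consisting of exactly $2^k-1$ subspaces of Type B and exactly two subspaces of Type A, and one of the two subspaces of Type A is $\{(x,\mathbf{0}): x\in\mathbb{F}_2^k\}$.
   Context: Vectors of $\mathbb{F}_2^{2k}$ are written as $(x,y)$ with $x,y\in\mathbb{F}_2^k$. A $(2k,M,2k,k)_2$ code is a set of $M$ $k$-dimensional subspaces of $\mathbb{F}_2^{2k}$ pairwise intersecting in $\{0\}$. A spread in $\mathcal{G}_2(2k,k)$ is a set of $k$-dimensional subspaces of $\mathbb{F}_2^{2k}$ such that every nonzero vector lies in exactly one of them. A $k$-dimensional subspace $Y$ of $\mathbb{F}_2^{2k}$ is of Type A if for each nonzero $x\in\mathbb{F}_2^k$ it contains exactly one vector with first $k$ entries equal to $x$, and it contains no nonzero vector whose first $k$ entries are zero; it is of Type B if it contains exactly one nonzero vector whose first $k$ entries are zero. -}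

module Defs where

open import Data.Bool using (Bool; true; false; if_then_else_; _xor_)
open import Data.Nat using (ℕ; _+_; _^_; suc)
open import Data.Fin using (Fin)
open import Data.Vec using (Vec; []; _∷_; replicate; zipWith; _++_)
open import Data.Product using (Σ; ∃; _×_; _,_)
open import Relation.Binary.PropositionalEquality using (_≡_; _≢_)

-- 𝔽₂ is Bool (false = 0, true = 1, addition = xor); 𝔽₂ⁿ is Vec Bool n.
𝔽₂^ : ℕ → Set
𝔽₂^ n = Vec Bool n

𝟎 : ∀ {n} → 𝔽₂^ n
𝟎 = replicate _ false

_⊕_ : ∀ {n} → 𝔽₂^ n → 𝔽₂^ n → 𝔽₂^ n
_⊕_ = zipWith _xor_

lincomb : ∀ {n m} → Vec Bool m → Vec (𝔽₂^ n) m → 𝔽₂^ n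
lincomb [] [] = 𝟎
lincomb (c ∷ cs) (b ∷ bs) = if c then b ⊕ lincomb cs bs else lincomb cs bs

Subset : ℕ → Set₁
Subset n = 𝔽₂^ n → Set

-- S is a d-dimensional subspace of 𝔽₂ⁿ: S has a basis of d vectors, i.e.
-- S is exactly the span of b, and b is linearly independent
-- (the coordinate map c ↦ Σ cᵢ bᵢ is injective).
IsSubspaceOfDim : ∀ {n} → ℕ → Subset n → Set
IsSubspaceOfDim {n} d S =
  Σ (Vec (𝔽₂^ n) d) λ b →
    (∀ v → S v → ∃ λ c → lincomb c b ≡ v) ×
    (∀ c → S (lincomb c b)) ×
    (∀ c c' → lincomb c b ≡ lincomb c' b → c ≡ c')

-- Vectors of 𝔽₂^{2k} are written (x , y) = x ++ y with x y ∈ 𝔽₂^k.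
Sub2k : ℕ → Set₁
Sub2k k = Subset (k + k)

-- A (2k, M, 2k, k)₂ code: M k-dimensional subspaces of 𝔽₂^{2k}
-- pairwise intersecting in {0} (hence in particular pairwise distinct).
IsCode : (k M : ℕ) → (Fin M → Sub2k k) → Set
IsCode k M C =
  (∀ i → IsSubspaceOfDim k (C i)) ×
  (∀ i j → i ≢ j → ∀ v → C i v → C j v → v ≡ 𝟎)

V₀ : ∀ k → Sub2k k
V₀ k v = ∃ λ (y : 𝔽₂^ k) → v ≡ 𝟎 ++ y

H₀ : ∀ k → Sub2k k
H₀ k v = ∃ λ (x : 𝔽₂^ k) → v ≡ x ++ 𝟎

_≐_ : ∀ {n} → Subset n → Subset n → Set
S ≐ T = ∀ v → (S v → T v) × (T v → S v)

swap : ∀ k → Sub2k k → Sub2k k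
swap k Z v = Σ (𝔽₂^ k) λ x → Σ (𝔽₂^ k) λ y → (v ≡ y ++ x) × Z (x ++ y)

IsSpread : (k M : ℕ) → (Fin M → Sub2k k) → Set
IsSpread k M D =
  (∀ i → IsSubspaceOfDim k (D i)) ×
  (∀ v → v ≢ 𝟎 → Σ (Fin M) λ i → D i v × (∀ j → D j v → j ≡ i))

TypeA : ∀ k → Sub2k k → Set
TypeA k Y =
  (∀ (x : 𝔽₂^ k) → x ≢ 𝟎 →
     Σ (𝔽₂^ k) λ y → Y (x ++ y) × (∀ y' → Y (x ++ y') → y' ≡ y)) ×
  (∀ (y : 𝔽₂^ k) → Y (𝟎 ++ y) → y ≡ 𝟎)

TypeB : ∀ k → Sub2k k → Set
TypeB k Y =
  Σ (𝔽₂^ k) λ y → y ≢ 𝟎 × Y (𝟎 ++ y) ×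
    (∀ y' → y' ≢ 𝟎 → Y (𝟎 ++ y') → y' ≡ y)

module Submission where

-- Swapping the two halves of 𝔽₂²ᵏ is a linear involution, so it maps k-dimensional subspaces to
-- k-dimensional subspaces and preserves trivial intersections; and the code is already a spread,
-- since 2ᵏ + 1 subspaces meeting pairwise in 0 contain (2ᵏ + 1)(2ᵏ − 1) = 2²ᵏ − 1 nonzero vectors.
-- The type of a swapped codeword is decided by the nonzero "horizontal" vectors (x , 0) of the
-- original: with none, the projection onto the second half is injective on it, hence bijective,
-- and the swap is of Type A; with exactly one, the swap is of Type B. V₀ has none and swaps to
-- {(x , 0)}. The 2ᵏ − 1 nonzero horizontal vectors lie in distinct codewords other than V₀, so
-- exactly one further codeword b has none, and all the others have exactly one.

open import Defs
open import Data.Bool using (Bool; false; true; _xor_)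
open import Data.Bool.Properties using (xor-assoc; xor-comm; xor-identityˡ; xor-identityʳ; xor-same)
  renaming (_≟_ to _≟ᵇ_)
open import Data.Empty using (⊥-elim)
open import Data.Fin using (Fin; zero; suc; punchIn)
open import Data.Fin.Properties using (any?; injective⇒≤; punchIn-injective; punchInᵢ≢i; 2↔Bool; *↔×)
  renaming (_≟_ to _≟ᶠ_)
open import Data.Nat using (ℕ; zero; suc; _+_; _*_; _^_; _≤_; _<_; _≥_; pred; NonZero; s≤s)
open import Data.Nat.Properties
  using (1+n≰n; m+1+n≰m; <⇒≱; ≤-reflexive; +-comm; suc-pred; m^n≢0; ^-distribˡ-+-*)
open import Data.Nat.Tactic.RingSolver using (solve-∀)
open import Data.Product using (Σ; ∃; _×_; _,_; proj₁; proj₂)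
open import Data.Product.Function.NonDependent.Propositional using (_×-↔_)
open import Data.Vec using (Vec; []; _∷_; _++_; map; take; drop)
open import Data.Vec.Properties
  using (≡-dec; zipWith-assoc; zipWith-identityˡ; zipWith-identityʳ; zipWith-++;
         ++-injective; ++-injectiveˡ; take++drop≡id)
open import Data.Vec.Relation.Binary.Pointwise.Inductive using (zipWith-comm; Pointwise-≡⇒≡)
import Data.Vec.Functional as Fun
open import Function using (_∘_)
open import Function.Bundles using (_↔_; Inverse; Injection; mk↔ₛ′)
open import Function.Definitions using (Injective)
open import Function.Properties.Inverse using (↔-trans; ↔-sym; ↔⇒↣)
open import Relation.Binary.Definitions using (DecidableEquality)
open import Relation.Binary.PropositionalEquality
open import Relation.Nullary using (¬_; Dec; yes; no)
open import Relation.Nullary.Decidable using (map′; ¬?; _×-dec_; decidable-stable)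
open import Relation.Unary using (Decidable)

-- The vector space 𝔽₂ⁿ

⊕-assoc : ∀ {n} (u v w : 𝔽₂^ n) → (u ⊕ v) ⊕ w ≡ u ⊕ (v ⊕ w)
⊕-assoc = zipWith-assoc xor-assoc

⊕-comm : ∀ {n} (u v : 𝔽₂^ n) → u ⊕ v ≡ v ⊕ u
⊕-comm u v = Pointwise-≡⇒≡ (zipWith-comm xor-comm u v)

⊕-identityˡ : ∀ {n} (u : 𝔽₂^ n) → 𝟎 ⊕ u ≡ u
⊕-identityˡ = zipWith-identityˡ xor-identityˡ

⊕-identityʳ : ∀ {n} (u : 𝔽₂^ n) → u ⊕ 𝟎 ≡ u
⊕-identityʳ = zipWith-identityʳ xor-identityʳ

⊕-self : ∀ {n} (u : 𝔽₂^ n) → u ⊕ u ≡ 𝟎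
⊕-self []      = refl
⊕-self (a ∷ u) = cong₂ _∷_ (xor-same a) (⊕-self u)

⊕-leftComm : ∀ {n} (u v w : 𝔽₂^ n) → u ⊕ (v ⊕ w) ≡ v ⊕ (u ⊕ w)
⊕-leftComm u v w = begin
  u ⊕ (v ⊕ w) ≡⟨ ⊕-assoc u v w ⟨
  (u ⊕ v) ⊕ w ≡⟨ cong (_⊕ w) (⊕-comm u v) ⟩
  (v ⊕ u) ⊕ w ≡⟨ ⊕-assoc v u w ⟩
  v ⊕ (u ⊕ w) ∎
  where open ≡-Reasoning

⊕≡𝟎⇒≡ : ∀ {n} {u v : 𝔽₂^ n} → u ⊕ v ≡ 𝟎 → u ≡ v
⊕≡𝟎⇒≡ {u = u} {v} u⊕v≡𝟎 = begin
  u             ≡⟨ ⊕-identityʳ u ⟨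
  u ⊕ 𝟎         ≡⟨ cong (u ⊕_) (⊕-self v) ⟨
  u ⊕ (v ⊕ v)   ≡⟨ ⊕-assoc u v v ⟨
  (u ⊕ v) ⊕ v   ≡⟨ cong (_⊕ v) u⊕v≡𝟎 ⟩
  𝟎 ⊕ v         ≡⟨ ⊕-identityˡ v ⟩
  v             ∎
  where open ≡-Reasoning

𝟎++𝟎 : ∀ m {n} → 𝟎 {m} ++ 𝟎 {n} ≡ 𝟎
𝟎++𝟎 zero    = refl
𝟎++𝟎 (suc m) = cong (false ∷_) (𝟎++𝟎 m)

++𝟎-≢𝟎 : ∀ {m n} {x : 𝔽₂^ m} → x ≢ 𝟎 → x ++ 𝟎 {n} ≢ 𝟎
++𝟎-≢𝟎 {m} {x = x} x≢𝟎 x++𝟎≡𝟎 = x≢𝟎 (++-injectiveˡ x 𝟎 (trans x++𝟎≡𝟎 (sym (𝟎++𝟎 m))))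

_≟_ : ∀ {n} → DecidableEquality (𝔽₂^ n)
_≟_ = ≡-dec _≟ᵇ_

Additive : ∀ {m n} → (𝔽₂^ m → 𝔽₂^ n) → Set
Additive f = ∀ u v → f (u ⊕ v) ≡ f u ⊕ f v

additive⇒𝟎 : ∀ {m n} {f : 𝔽₂^ m → 𝔽₂^ n} → Additive f → f 𝟎 ≡ 𝟎
additive⇒𝟎 {f = f} f-additive = begin
  f 𝟎             ≡⟨ cong f (⊕-self 𝟎) ⟨
  f (𝟎 ⊕ 𝟎)       ≡⟨ f-additive 𝟎 𝟎 ⟩
  f 𝟎 ⊕ f 𝟎       ≡⟨ ⊕-self (f 𝟎) ⟩
  𝟎               ∎
  where open ≡-Reasoning

lincomb-𝟎 : ∀ {n m} (b : Vec (𝔽₂^ n) m) → lincomb 𝟎 b ≡ 𝟎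
lincomb-𝟎 []      = refl
lincomb-𝟎 (_ ∷ b) = lincomb-𝟎 b

lincomb-⊕ : ∀ {n m} (c c' : Vec Bool m) (b : Vec (𝔽₂^ n) m) →
            lincomb (c ⊕ c') b ≡ lincomb c b ⊕ lincomb c' b
lincomb-⊕ []          []           []      = sym (⊕-self 𝟎)
lincomb-⊕ (false ∷ c) (false ∷ c') (x ∷ b) = lincomb-⊕ c c' b
lincomb-⊕ (true ∷ c)  (false ∷ c') (x ∷ b) =
  trans (cong (x ⊕_) (lincomb-⊕ c c' b)) (sym (⊕-assoc x _ _))
lincomb-⊕ (false ∷ c) (true ∷ c')  (x ∷ b) =
  trans (cong (x ⊕_) (lincomb-⊕ c c' b)) (⊕-leftComm x _ _)
lincomb-⊕ (true ∷ c)  (true ∷ c')  (x ∷ b) = begin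
  lincomb (c ⊕ c') b        ≡⟨ lincomb-⊕ c c' b ⟩
  L ⊕ L'                    ≡⟨ ⊕-identityˡ (L ⊕ L') ⟨
  𝟎 ⊕ (L ⊕ L')              ≡⟨ cong (_⊕ (L ⊕ L')) (⊕-self x) ⟨
  (x ⊕ x) ⊕ (L ⊕ L')        ≡⟨ ⊕-assoc x x (L ⊕ L') ⟩
  x ⊕ (x ⊕ (L ⊕ L'))        ≡⟨ cong (x ⊕_) (⊕-leftComm x L L') ⟩
  x ⊕ (L ⊕ (x ⊕ L'))        ≡⟨ ⊕-assoc x L (x ⊕ L') ⟨
  (x ⊕ L) ⊕ (x ⊕ L')        ∎
  where
  open ≡-Reasoning
  L  = lincomb c b
  L' = lincomb c' b

lincomb-map : ∀ {m n d} {f : 𝔽₂^ m → 𝔽₂^ n} → Additive f →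
              (c : Vec Bool d) (b : Vec (𝔽₂^ m) d) → lincomb c (map f b) ≡ f (lincomb c b)
lincomb-map f-additive []          []      = sym (additive⇒𝟎 f-additive)
lincomb-map f-additive (false ∷ c) (x ∷ b) = lincomb-map f-additive c b
lincomb-map f-additive (true ∷ c)  (x ∷ b) =
  trans (cong (_ ⊕_) (lincomb-map f-additive c b)) (sym (f-additive x _))

-- Counting in finite types

𝔽₂^↔Fin : ∀ n → 𝔽₂^ n ↔ Fin (2 ^ n)
𝔽₂^↔Fin zero    = mk↔ₛ′ (λ _ → zero) (λ _ → []) (λ { zero → refl }) (λ { [] → refl })
𝔽₂^↔Fin (suc n) = ↔-trans ∷↔× (↔-trans (↔-sym 2↔Bool ×-↔ 𝔽₂^↔Fin n) (↔-sym *↔×))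
  where
  ∷↔× : 𝔽₂^ (suc n) ↔ (Bool × 𝔽₂^ n)
  ∷↔× = mk↔ₛ′ (λ { (a ∷ u) → a , u }) (λ (a , u) → a ∷ u) (λ _ → refl) (λ { (a ∷ u) → refl })

module _ {A : Set} {n : ℕ} (A↔Fin : A ↔ Fin n) where
  open Inverse A↔Fin

  any?-↔Fin : ∀ {P : A → Set} → Decidable P → Dec (∃ P)
  any?-↔Fin {P} P? =
    map′ (λ (i , p) → from i , p) (λ (x , p) → to x , subst P (sym (strictlyInverseʳ x)) p)
      (any? (P? ∘ from))

  injective⇒≤-↔Fin : ∀ {m} {f : Fin m → A} → Injective _≡_ _≡_ f → m ≤ n
  injective⇒≤-↔Fin f-injective = injective⇒≤ (f-injective ∘ Injection.injective (↔⇒↣ A↔Fin))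

injective-∷ : ∀ {A : Set} {m} {f : Fin m → A} {a : A} →
              Injective _≡_ _≡_ f → (∀ i → f i ≢ a) → Injective _≡_ _≡_ (a Fun.∷ f)
injective-∷ f-injective a∉f {zero}  {zero}  _  = refl
injective-∷ f-injective a∉f {zero}  {suc j} eq = ⊥-elim (a∉f j (sym eq))
injective-∷ f-injective a∉f {suc i} {zero}  eq = ⊥-elim (a∉f i eq)
injective-∷ f-injective a∉f {suc i} {suc j} eq = cong suc (f-injective eq)

∉-∷ : ∀ {A : Set} {m} {f : Fin m → A} {a b : A} → a ≢ b → (∀ i → f i ≢ b) → ∀ i → (a Fun.∷ f) i ≢ b
∉-∷ a≢b b∉f zero    = a≢b
∉-∷ a≢b b∉f (suc i) = b∉f i

module _ {A : Set} {n : ℕ} (A↔Fin : A ↔ Fin n) (_≟ᴬ_ : DecidableEquality A) where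
  open Inverse A↔Fin

  injective⇒surjective-↔Fin : ∀ {f : A → A} → Injective _≡_ _≡_ f → ∀ y → ∃ λ x → f x ≡ y
  injective⇒surjective-↔Fin {f} f-injective y with any?-↔Fin A↔Fin (λ x → f x ≟ᴬ y)
  ... | yes hit = hit
  ... | no  miss =
    ⊥-elim (1+n≰n (injective⇒≤-↔Fin A↔Fin (injective-∷ (from-injective ∘ f-injective) y∉)))
    where
    from-injective : Injective _≡_ _≡_ from
    from-injective = Injection.injective (↔⇒↣ (↔-sym A↔Fin))
    y∉ : ∀ i → f (from i) ≢ y
    y∉ i eq = miss (from i , eq)

module _ {A : Set} {n : ℕ} (A↔Fin : A ↔ Fin (suc n)) (a : A) where
  open Inverse A↔Fin

  enumerate-except : Fin n → A
  enumerate-except = from ∘ punchIn (to a)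

  enumerate-except-injective : Injective _≡_ _≡_ enumerate-except
  enumerate-except-injective {i} {j} eq = punchIn-injective (to a) i j (begin
    punchIn (to a) i                  ≡⟨ strictlyInverseˡ _ ⟨
    to (enumerate-except i)           ≡⟨ cong to eq ⟩
    to (enumerate-except j)           ≡⟨ strictlyInverseˡ _ ⟩
    punchIn (to a) j                  ∎)
    where open ≡-Reasoning

  enumerate-except-≢ : ∀ i → enumerate-except i ≢ a
  enumerate-except-≢ i eq = punchInᵢ≢i (to a) i (trans (sym (strictlyInverseˡ _)) (cong to eq))

𝔽₂^↔Fin-suc : ∀ k → 𝔽₂^ k ↔ Fin (suc (pred (2 ^ k)))
𝔽₂^↔Fin-suc k = subst (λ N → 𝔽₂^ k ↔ Fin N) (sym (suc-pred (2 ^ k) {{m^n≢0 2 k}})) (𝔽₂^↔Fin k)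

nonzeroVector : ∀ k → Fin (pred (2 ^ k)) → 𝔽₂^ k
nonzeroVector k = enumerate-except (𝔽₂^↔Fin-suc k) 𝟎

nonzeroVector-injective : ∀ k → Injective _≡_ _≡_ (nonzeroVector k)
nonzeroVector-injective k = enumerate-except-injective (𝔽₂^↔Fin-suc k) 𝟎

nonzeroVector-≢𝟎 : ∀ k j → nonzeroVector k j ≢ 𝟎
nonzeroVector-≢𝟎 k = enumerate-except-≢ (𝔽₂^↔Fin-suc k) 𝟎

-- Subspaces

module Subspace {n d} {S : Subset n} (S-subspace : IsSubspaceOfDim d S) where

  basis : Vec (𝔽₂^ n) d
  basis = proj₁ S-subspace

  coordinates : ∀ v → S v → ∃ λ c → lincomb c basis ≡ v
  coordinates = proj₁ (proj₂ S-subspace)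

  lincomb∈ : ∀ c → S (lincomb c basis)
  lincomb∈ = proj₁ (proj₂ (proj₂ S-subspace))

  independent : ∀ c c' → lincomb c basis ≡ lincomb c' basis → c ≡ c'
  independent = proj₂ (proj₂ (proj₂ S-subspace))

  lincomb≡𝟎⇒𝟎 : ∀ {c} → lincomb c basis ≡ 𝟎 → c ≡ 𝟎
  lincomb≡𝟎⇒𝟎 {c} eq = independent c 𝟎 (trans eq (sym (lincomb-𝟎 basis)))

  ⊕-closed : ∀ {u v} → S u → S v → S (u ⊕ v)
  ⊕-closed {u} {v} u∈S v∈S with coordinates u u∈S | coordinates v v∈S
  ... | c , refl | c' , refl = subst S (lincomb-⊕ c c' basis) (lincomb∈ (c ⊕ c'))

  ∈? : Decidable S
  ∈? v = map′ (λ (c , eq) → subst S eq (lincomb∈ c)) (coordinates v)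
    (any?-↔Fin (𝔽₂^↔Fin d) (λ c → lincomb c basis ≟ v))

IsSubspaceOfDim-resp-≐ : ∀ {n d} {S T : Subset n} → S ≐ T → IsSubspaceOfDim d S → IsSubspaceOfDim d T
IsSubspaceOfDim-resp-≐ S≐T (b , spanning , lincomb∈ , independent) =
  b , (λ v → spanning v ∘ proj₂ (S≐T v)) , (λ c → proj₁ (S≐T _) (lincomb∈ c)) , independent

preimage-isSubspace : ∀ {n d} {S : Subset n} {σ : 𝔽₂^ n → 𝔽₂^ n} →
                      Additive σ → (∀ v → σ (σ v) ≡ v) →
                      IsSubspaceOfDim d S → IsSubspaceOfDim d (λ v → S (σ v))
preimage-isSubspace {S = S} {σ} σ-additive σ-involutive (b , spanning , lincomb∈ , independent) =
  map σ b , spanning′ , lincomb∈′ , independent′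
  where
  σ-lincomb : ∀ c → lincomb c (map σ b) ≡ σ (lincomb c b)
  σ-lincomb c = lincomb-map σ-additive c b

  spanning′ : ∀ v → S (σ v) → ∃ λ c → lincomb c (map σ b) ≡ v
  spanning′ v σv∈S with spanning (σ v) σv∈S
  ... | c , eq = c , trans (σ-lincomb c) (trans (cong σ eq) (σ-involutive v))

  lincomb∈′ : ∀ c → S (σ (lincomb c (map σ b)))
  lincomb∈′ c = subst S (sym (trans (cong σ (σ-lincomb c)) (σ-involutive _))) (lincomb∈ c)

  independent′ : ∀ c c' → lincomb c (map σ b) ≡ lincomb c' (map σ b) → c ≡ c'
  independent′ c c' eq = independent c c' (begin
    lincomb c b              ≡⟨ σ-involutive _ ⟨
    σ (σ (lincomb c b))      ≡⟨ cong σ (trans (sym (σ-lincomb c)) (trans eq (σ-lincomb c'))) ⟩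
    σ (σ (lincomb c' b))     ≡⟨ σ-involutive _ ⟩
    lincomb c' b             ∎)
    where open ≡-Reasoning

-- Swapping the two halves

swapHalves : ∀ k → 𝔽₂^ (k + k) → 𝔽₂^ (k + k)
swapHalves k v = drop k v ++ take k v

take-drop-++ : ∀ {A : Set} {m n} (x : Vec A m) (y : Vec A n) → take m (x ++ y) ≡ x × drop m (x ++ y) ≡ y
take-drop-++ {m = m} x y = ++-injective _ x (take++drop≡id m (x ++ y))

swapHalves-++ : ∀ {k} (x y : 𝔽₂^ k) → swapHalves k (x ++ y) ≡ y ++ x
swapHalves-++ x y = cong₂ _++_ (proj₂ (take-drop-++ x y)) (proj₁ (take-drop-++ x y))

swapHalves-involutive : ∀ k v → swapHalves k (swapHalves k v) ≡ v
swapHalves-involutive k v = trans (swapHalves-++ (drop k v) (take k v)) (take++drop≡id k v)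

swapHalves-⊕-++ : ∀ {k} (x y x' y' : 𝔽₂^ k) →
                  swapHalves k ((x ++ y) ⊕ (x' ++ y')) ≡ swapHalves k (x ++ y) ⊕ swapHalves k (x' ++ y')
swapHalves-⊕-++ {k} x y x' y' = begin
  swapHalves k ((x ++ y) ⊕ (x' ++ y'))             ≡⟨ cong (swapHalves k) (zipWith-++ _xor_ x y x' y') ⟩
  swapHalves k ((x ⊕ x') ++ (y ⊕ y'))              ≡⟨ swapHalves-++ (x ⊕ x') (y ⊕ y') ⟩
  (y ⊕ y') ++ (x ⊕ x')                             ≡⟨ zipWith-++ _xor_ y x y' x' ⟨
  (y ++ x) ⊕ (y' ++ x')                            ≡⟨ cong₂ _⊕_ (swapHalves-++ x y) (swapHalves-++ x' y') ⟨
  swapHalves k (x ++ y) ⊕ swapHalves k (x' ++ y')  ∎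
  where open ≡-Reasoning

swapHalves-additive : ∀ k → Additive (swapHalves k)
swapHalves-additive k u v =
  subst₂ (λ u v → swapHalves k (u ⊕ v) ≡ swapHalves k u ⊕ swapHalves k v)
    (take++drop≡id k u) (take++drop≡id k v)
    (swapHalves-⊕-++ (take k u) (drop k u) (take k v) (drop k v))

swapHalves-≢𝟎 : ∀ k {v} → v ≢ 𝟎 → swapHalves k v ≢ 𝟎
swapHalves-≢𝟎 k {v} v≢𝟎 eq = v≢𝟎 (begin
  v                              ≡⟨ swapHalves-involutive k v ⟨
  swapHalves k (swapHalves k v)  ≡⟨ cong (swapHalves k) eq ⟩
  swapHalves k 𝟎                 ≡⟨ additive⇒𝟎 (swapHalves-additive k) ⟩
  𝟎                              ∎)
  where open ≡-Reasoning

swap-intro : ∀ {k} (Z : Sub2k k) (x y : 𝔽₂^ k) → Z (y ++ x) → swap k Z (x ++ y)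
swap-intro Z x y y++x∈Z = y , x , refl , y++x∈Z

swap-elim : ∀ {k} (Z : Sub2k k) (x y : 𝔽₂^ k) → swap k Z (x ++ y) → Z (y ++ x)
swap-elim Z x y (_ , y′ , eq , z) with ++-injective x y′ eq
... | refl , refl = z

preimage≐swap : ∀ k (Z : Sub2k k) → (λ v → Z (swapHalves k v)) ≐ swap k Z
preimage≐swap k Z v = to , from
  where
  to : Z (swapHalves k v) → swap k Z v
  to z = subst (swap k Z) (take++drop≡id k v) (swap-intro Z (take k v) (drop k v) z)
  from : swap k Z v → Z (swapHalves k v)
  from (x , y , refl , z) = subst Z (sym (swapHalves-++ y x)) z

swap-isSubspace : ∀ k {Z : Sub2k k} → IsSubspaceOfDim k Z → IsSubspaceOfDim k (swap k Z)
swap-isSubspace k {Z} = IsSubspaceOfDim-resp-≐ (preimage≐swap k Z)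
  ∘ preimage-isSubspace (swapHalves-additive k) (swapHalves-involutive k)

-- Horizontal vectors and the types of swapped subspaces

lift-unique : ∀ {m n d} {Z : Subset (m + n)} → IsSubspaceOfDim d Z →
              (∀ (y : 𝔽₂^ m) → Z (y ++ 𝟎 {n}) → y ≡ 𝟎) →
              ∀ {x : 𝔽₂^ n} {y y' : 𝔽₂^ m} → Z (y ++ x) → Z (y' ++ x) → y ≡ y'
lift-unique {Z = Z} Z-subspace horizontal-free {x} {y} {y'} z z' =
  ⊕≡𝟎⇒≡ (horizontal-free (y ⊕ y') (subst Z difference (Subspace.⊕-closed Z-subspace z z')))
  where
  difference : (y ++ x) ⊕ (y' ++ x) ≡ (y ⊕ y') ++ 𝟎
  difference = trans (zipWith-++ _xor_ y x y' x) (cong ((y ⊕ y') ++_) (⊕-self x))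

-- The projection onto the last n coordinates is injective on Z, hence onto.
lift-exists : ∀ {m n} {Z : Subset (m + n)} → IsSubspaceOfDim n Z →
              (∀ (y : 𝔽₂^ m) → Z (y ++ 𝟎 {n}) → y ≡ 𝟎) →
              ∀ (x : 𝔽₂^ n) → ∃ λ (y : 𝔽₂^ m) → Z (y ++ x)
lift-exists {m} {n} {Z} Z-subspace horizontal-free x =
  let c , φc≡x = injective⇒surjective-↔Fin (𝔽₂^↔Fin n) _≟_ φ-injective x in
  take m (lincomb c basis) , subst (λ x → Z (take m (lincomb c basis) ++ x)) φc≡x (split∈ c)
  where
  open Subspace Z-subspace
  φ : 𝔽₂^ n → 𝔽₂^ n
  φ c = drop m (lincomb c basis)
  split∈ : ∀ c → Z (take m (lincomb c basis) ++ φ c)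
  split∈ c = subst Z (sym (take++drop≡id m _)) (lincomb∈ c)
  φ-injective : Injective _≡_ _≡_ φ
  φ-injective {c} {c'} φc≡φc' = independent c c' (begin
    lincomb c basis                              ≡⟨ take++drop≡id m _ ⟨
    take m (lincomb c basis) ++ φ c              ≡⟨ cong₂ _++_ same-take φc≡φc' ⟩
    take m (lincomb c' basis) ++ φ c'            ≡⟨ take++drop≡id m _ ⟩
    lincomb c' basis                             ∎)
    where
    open ≡-Reasoning
    same-take : take m (lincomb c basis) ≡ take m (lincomb c' basis)
    same-take = lift-unique {m} {n} Z-subspace horizontal-free (split∈ c)
      (subst (λ x → Z (take m (lincomb c' basis) ++ x)) (sym φc≡φc') (split∈ c'))

Horizontal : ∀ {k} → Sub2k k → Set
Horizontal {k} Z = ∃ λ (x : 𝔽₂^ k) → x ≢ 𝟎 × Z (x ++ 𝟎)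

AtMostOneHorizontal : ∀ {k} → Sub2k k → Set
AtMostOneHorizontal {k} Z = ∀ (x x' : 𝔽₂^ k) → x ≢ 𝟎 → x' ≢ 𝟎 → Z (x ++ 𝟎) → Z (x' ++ 𝟎) → x ≡ x'

swap-TypeA : ∀ {k} {Z : Sub2k k} → IsSubspaceOfDim k Z → ¬ Horizontal Z → TypeA k (swap k Z)
swap-TypeA {k} {Z} Z-subspace ¬horizontal = unique-lift , λ y → horizontal-free y ∘ swap-elim Z 𝟎 y
  where
  horizontal-free : ∀ y → Z (y ++ 𝟎) → y ≡ 𝟎
  horizontal-free y z with y ≟ 𝟎
  ... | yes y≡𝟎 = y≡𝟎
  ... | no  y≢𝟎 = ⊥-elim (¬horizontal (y , y≢𝟎 , z))
  unique-lift : ∀ (x : 𝔽₂^ k) → x ≢ 𝟎 →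
                Σ (𝔽₂^ k) λ y → swap k Z (x ++ y) × (∀ y' → swap k Z (x ++ y') → y' ≡ y)
  unique-lift x _ with y , z ← lift-exists {k} Z-subspace horizontal-free x =
    y , swap-intro Z x y z ,
    λ y' z' → lift-unique {k} {k} Z-subspace horizontal-free (swap-elim Z x y' z') z

swap-TypeB : ∀ {k} {Z : Sub2k k} → Horizontal Z → AtMostOneHorizontal Z → TypeB k (swap k Z)
swap-TypeB {Z = Z} (x , x≢𝟎 , z) at-most-one =
  x , x≢𝟎 , swap-intro Z 𝟎 x z , λ y y≢𝟎 z' → at-most-one y x y≢𝟎 x≢𝟎 (swap-elim Z 𝟎 y z') z

swap-V₀≐H₀ : ∀ {k} {Z : Sub2k k} → Z ≐ V₀ k → swap k Z ≐ H₀ k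
swap-V₀≐H₀ {k} {Z} Z≐V₀ v = to , from
  where
  to : swap k Z v → H₀ k v
  to (x , y , refl , z) with _ , x++y≡𝟎++w ← proj₁ (Z≐V₀ _) z
    rewrite ++-injectiveˡ x 𝟎 x++y≡𝟎++w = y , refl
  from : H₀ k v → swap k Z v
  from (x , refl) = swap-intro Z x 𝟎 (proj₂ (Z≐V₀ _) (x , refl))

V₀-¬horizontal : ∀ {k} {Z : Sub2k k} → Z ≐ V₀ k → ¬ Horizontal Z
V₀-¬horizontal {k} Z≐V₀ (x , x≢𝟎 , z) with _ , eq ← proj₁ (Z≐V₀ _) z = x≢𝟎 (++-injectiveˡ x (𝟎 {k}) eq)

-- Codes with 2ᵏ + 1 codewords

N*N<2+[N+1]*pred[N] : ∀ N .{{_ : NonZero N}} → N * N < 2 + (N + 1) * pred N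
N*N<2+[N+1]*pred[N] (suc p) = ≤-reflexive (expand p)
  where
  expand : ∀ p → suc (suc p * suc p) ≡ 2 + (suc p + 1) * p
  expand = solve-∀

N+1<3+pred[N] : ∀ N .{{_ : NonZero N}} → N + 1 < 3 + pred N
N+1<3+pred[N] (suc p) = s≤s (s≤s (≤-reflexive (+-comm p 1)))

module Code {k : ℕ} {C : Fin (2 ^ k + 1) → Sub2k k} (code : IsCode k (2 ^ k + 1) C) where

  codeword : ∀ i → IsSubspaceOfDim k (C i)
  codeword = proj₁ code

  same-codeword : ∀ {i j v} → v ≢ 𝟎 → C i v → C j v → i ≡ j
  same-codeword {i} {j} {v} v≢𝟎 v∈Ci v∈Cj with i ≟ᶠ j
  ... | yes i≡j = i≡j
  ... | no  i≢j = ⊥-elim (v≢𝟎 (proj₂ code i j i≢j v v∈Ci v∈Cj))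

  covers : ∀ v → v ≢ 𝟎 → ∃ λ i → C i v
  covers v v≢𝟎 with any? (λ i → Subspace.∈? (codeword i) v)
  ... | yes hit = hit
  ... | no miss = ⊥-elim (<⇒≱ too-many (injective⇒≤-↔Fin (𝔽₂^↔Fin (k + k)) F-injective))
    where
    too-many : 2 ^ (k + k) < 2 + (2 ^ k + 1) * pred (2 ^ k)
    too-many = subst (_< 2 + (2 ^ k + 1) * pred (2 ^ k)) (sym (^-distribˡ-+-* 2 k k))
      (N*N<2+[N+1]*pred[N] (2 ^ k) {{m^n≢0 2 k}})

    w : Fin (2 ^ k + 1) × Fin (pred (2 ^ k)) → 𝔽₂^ (k + k)
    w (i , j) = lincomb (nonzeroVector k j) (Subspace.basis (codeword i))

    w∈C : ∀ i j → C i (w (i , j))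
    w∈C i j = Subspace.lincomb∈ (codeword i) (nonzeroVector k j)

    w≢𝟎 : ∀ ij → w ij ≢ 𝟎
    w≢𝟎 (i , j) = nonzeroVector-≢𝟎 k j ∘ Subspace.lincomb≡𝟎⇒𝟎 (codeword i)

    w≢v : ∀ ij → w ij ≢ v
    w≢v (i , j) w≡v = miss (i , subst (C i) w≡v (w∈C i j))

    w-injective : Injective _≡_ _≡_ w
    w-injective {i , j} {i' , j'} eq
      with same-codeword (w≢𝟎 (i , j)) (w∈C i j) (subst (C i') (sym eq) (w∈C i' j'))
    ... | refl = cong (i ,_) (nonzeroVector-injective k (Subspace.independent (codeword i) _ _ eq))

    F : Fin (2 + (2 ^ k + 1) * pred (2 ^ k)) → 𝔽₂^ (k + k)
    F = 𝟎 Fun.∷ v Fun.∷ (w ∘ Inverse.to *↔×)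

    F-injective : Injective _≡_ _≡_ F
    F-injective =
      injective-∷ (injective-∷ (Injection.injective (↔⇒↣ *↔×) ∘ w-injective) (w≢v ∘ Inverse.to *↔×))
        (∉-∷ v≢𝟎 (w≢𝟎 ∘ Inverse.to *↔×))

  swap-isSpread : IsSpread k (2 ^ k + 1) (λ i → swap k (C i))
  swap-isSpread = (λ i → swap-isSubspace k (codeword i)) , cover
    where
    cover : ∀ v → v ≢ 𝟎 →
            Σ (Fin (2 ^ k + 1)) λ i → swap k (C i) v × (∀ j → swap k (C j) v → j ≡ i)
    cover v v≢𝟎 with i , σv∈Ci ← covers (swapHalves k v) (swapHalves-≢𝟎 k v≢𝟎) =
      i , proj₁ (preimage≐swap k (C i) v) σv∈Ci ,
      λ j v∈swapCj →
        same-codeword (swapHalves-≢𝟎 k v≢𝟎) (proj₂ (preimage≐swap k (C j) v) v∈swapCj) σv∈Ci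

  horizontal? : ∀ i → Dec (Horizontal (C i))
  horizontal? i = any?-↔Fin (𝔽₂^↔Fin k) (λ x → ¬? (x ≟ 𝟎) ×-dec Subspace.∈? (codeword i) (x ++ 𝟎))

  -- Otherwise sending a to 0 and every other codeword to a nonzero (x , 0) in it
  -- would inject the 2ᵏ + 1 codewords into 𝔽₂ᵏ.
  horizontal-free-exists : ∀ a → ∃ λ b → b ≢ a × ¬ Horizontal (C b)
  horizontal-free-exists a with any? (λ b → ¬? (b ≟ᶠ a) ×-dec ¬? (horizontal? b))
  ... | yes found = found
  ... | no none = ⊥-elim (m+1+n≰m (2 ^ k) (injective⇒≤-↔Fin (𝔽₂^↔Fin k) g-injective))
    where
    horizontal : ∀ i → i ≢ a → Horizontal (C i)
    horizontal i i≢a = decidable-stable (horizontal? i) (λ ¬h → none (i , i≢a , ¬h))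

    g : Fin (2 ^ k + 1) → 𝔽₂^ k
    g i with i ≟ᶠ a
    ... | yes _   = 𝟎
    ... | no i≢a  = proj₁ (horizontal i i≢a)

    g-injective : Injective _≡_ _≡_ g
    g-injective {i} {j} eq with i ≟ᶠ a | j ≟ᶠ a
    ... | yes refl | yes refl = refl
    ... | yes _    | no j≢a   = ⊥-elim (proj₁ (proj₂ (horizontal j j≢a)) (sym eq))
    ... | no i≢a   | yes _    = ⊥-elim (proj₁ (proj₂ (horizontal i i≢a)) eq)
    ... | no i≢a   | no j≢a   with horizontal i i≢a | horizontal j j≢a
    ...   | x , x≢𝟎 , x∈Ci | _ , _ , x'∈Cj =
      same-codeword (++𝟎-≢𝟎 x≢𝟎) x∈Ci (subst (λ x → C j (x ++ 𝟎)) (sym eq) x'∈Cj)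

  -- Distinct nonzero vectors (x , 0) lie in distinct codewords, none of them a, b or i:
  -- 2ᵏ − 1 codewords among the 2ᵏ − 2 others.
  others-horizontal : (∀ i → AtMostOneHorizontal (C i)) →
                      ∀ {a b} → ¬ Horizontal (C a) → ¬ Horizontal (C b) → b ≢ a →
                      ∀ i → i ≢ a → i ≢ b → Horizontal (C i)
  others-horizontal at-most-one {a} {b} a-free b-free b≢a i i≢a i≢b with horizontal? i
  ... | yes i-horizontal = i-horizontal
  ... | no  i-free = ⊥-elim (<⇒≱ (N+1<3+pred[N] (2 ^ k) {{m^n≢0 2 k}}) (injective⇒≤ a∷b∷i∷h-injective))
    where
    containing : ∀ j → ∃ λ c → C c (nonzeroVector k j ++ 𝟎)
    containing j = covers _ (++𝟎-≢𝟎 (nonzeroVector-≢𝟎 k j))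

    h : Fin (pred (2 ^ k)) → Fin (2 ^ k + 1)
    h = proj₁ ∘ containing

    h-misses : ∀ {c} → ¬ Horizontal (C c) → ∀ j → h j ≢ c
    h-misses c-free j refl = c-free (nonzeroVector k j , nonzeroVector-≢𝟎 k j , proj₂ (containing j))

    h-injective : Injective _≡_ _≡_ h
    h-injective {j} {j'} eq = nonzeroVector-injective k
      (at-most-one (h j) _ _ (nonzeroVector-≢𝟎 k j) (nonzeroVector-≢𝟎 k j') (proj₂ (containing j))
        (subst (λ c → C c (nonzeroVector k j' ++ 𝟎)) (sym eq) (proj₂ (containing j'))))

    a∷b∷i∷h-injective : Injective _≡_ _≡_ (a Fun.∷ b Fun.∷ i Fun.∷ h)
    a∷b∷i∷h-injective =
      injective-∷ (injective-∷ (injective-∷ h-injective (h-misses i-free)) (∉-∷ i≢b (h-misses b-free)))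
        (∉-∷ b≢a (∉-∷ i≢a (h-misses a-free)))

-- The hypothesis k ≥ 1 is deliberately unused: the argument also covers k = 0.
mainTheorem14 : (k : ℕ) → k ≥ 1 →
    (C : Fin (2 ^ k + 1) → Sub2k k) →
    IsCode k (2 ^ k + 1) C →
    Σ (Fin (2 ^ k + 1)) (λ i → C i ≐ V₀ k) →
    (∀ i (x x' : 𝔽₂^ k) → x ≢ 𝟎 → x' ≢ 𝟎 →
       C i (x ++ 𝟎) → C i (x' ++ 𝟎) → x ≡ x') →
    IsSpread k (2 ^ k + 1) (λ i → swap k (C i)) ×
    Σ (Fin (2 ^ k + 1)) (λ a → Σ (Fin (2 ^ k + 1)) (λ b →
      a ≢ b ×
      TypeA k (swap k (C a)) × TypeA k (swap k (C b)) ×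
      (∀ i → i ≢ a → i ≢ b → TypeB k (swap k (C i))) ×
      (swap k (C a) ≐ H₀ k)))
mainTheorem14 k _ C code (a , Ca≐V₀) at-most-one
  with b , b≢a , b-free ← Code.horizontal-free-exists code a =
  swap-isSpread , a , b , b≢a ∘ sym ,
  swap-TypeA (codeword a) a-free , swap-TypeA (codeword b) b-free ,
  (λ i i≢a i≢b →
     swap-TypeB {Z = C i} (others-horizontal at-most-one a-free b-free b≢a i i≢a i≢b) (at-most-one i)) ,
  swap-V₀≐H₀ Ca≐V₀
  where
  open Code code
  a-free : ¬ Horizontal (C a)
  a-free = V₀-¬horizontal Ca≐V₀
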